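{- Let $z_1=(x_1,y_1)$ and $z_2=(x_2,y_2)$ be distinct points of $\mathbb{Z}^2$ with $x_2\ge x_1$ and $y_2\ge y_1$, so that $d(z_1,z_2)=(x_2-x_1)+(y_2-y_1)$. Let $d\ge d(z_1,z_2)$ be an integer, $c=d-d(z_1,z_2)$, and let ${\cal A}_d(z_1,z_2)$ be the optimal tristance anticode in ${\cal G}_2$ of diameter $d$ centered about $z_1$ and $z_2$. Then ${\cal A}_d(z_1,z_2)$ consists of all $(x,y)\in\mathbb{Z}^2$ such that $x_1-c\le x\le x_2+c$, $y_1-c\le y\le y_2+c$, $x_1+y_1-c\le x+y\le x_2+y_2+c$, and $x_1-y_2-c\le x-y\le x_2-y_1+c$.
   Context: The grid graph ${\cal G}_2$ has vertex set $\mathbb{Z}^2$, with $z,z'$ adjacent iff their $L_1$-distance $d(z,z')$ is $1$. For $z_1,z_2,z_3\in\mathbb{Z}^2$, the tristance $d_3(z_1,z_2,z_3)$ is the minimum number of edges of a tree in ${\cal G}_2$ (possibly using additional vertices) containing $z_1,z_2,z_3$. A set ${\cal A}\subset\mathbb{Z}^2$ is a tristance anticode of diameter $d$ centered about $z_1$ and $z_2$ if $d_3(z_1,z_2,z)\le d$ for all $z\in{\cal A}$; it is optimal if it has the largest possible cardinality among such sets. -}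

module Defs where

open import Data.Nat using (ℕ; zero; suc)
open import Data.Integer using (ℤ; +_; _+_; _-_; _≤_; ∣_∣)
open import Data.Product using (_×_; _,_; Σ; ∃; ∃-syntax)
open import Data.List using (List; []; _∷_; length)
open import Data.List.Membership.Propositional using (_∈_; _∉_)
open import Data.List.Relation.Unary.All using (All)
open import Data.List.Relation.Unary.Unique.Propositional using (Unique)
import Data.Nat as ℕ
open import Relation.Binary.PropositionalEquality using (_≡_)

Pt : Set
Pt = ℤ × ℤ

dist : Pt → Pt → ℕ
dist (x , y) (x' , y') = ∣ x - x' ∣ ℕ.+ ∣ y - y' ∣

Adj : Pt → Pt → Set
Adj z z' = dist z z' ≡ 1

-- Every finite tree is obtained from a single vertex by repeatedly
-- attaching a new leaf to an existing vertex (and conversely).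
data Tree : List Pt → ℕ → Set where
  single : (v : Pt) → Tree (v ∷ []) zero
  grow   : ∀ {V k} → Tree V k → (v w : Pt) → v ∈ V → Adj v w → w ∉ V →
           Tree (w ∷ V) (suc k)

-- d₃(z₁,z₂,z₃) ≤ d : some tree of G₂ with at most d edges contains z₁,z₂,z₃
-- (d₃ is the minimum number of edges of such a tree).
Tristance≤ : Pt → Pt → Pt → ℤ → Set
Tristance≤ z₁ z₂ z₃ d =
  ∃[ V ] ∃[ k ] (Tree V k × z₁ ∈ V × z₂ ∈ V × z₃ ∈ V × (+ k) ≤ d)

-- finite sets of points are duplicate-free lists
IsAnticode : ℤ → Pt → Pt → List Pt → Set
IsAnticode d z₁ z₂ A = Unique A × All (λ z → Tristance≤ z₁ z₂ z d) A

IsOptimalAnticode : ℤ → Pt → Pt → List Pt → Set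
IsOptimalAnticode d z₁ z₂ A =
  IsAnticode d z₁ z₂ A ×
  (∀ (B : List Pt) → IsAnticode d z₁ z₂ B → length B ℕ.≤ length A)

-- A tree with k edges spans a bounding box of half-perimeter at most k, since attaching a
-- leaf moves one coordinate by one.  Conversely, three points are joined by the star of
-- L₁-paths from their coordinatewise median, whose length is exactly the half-perimeter of
-- their bounding box.  So d₃(z₁,z₂,z) is that half-perimeter, and when z₁ ≤ z₂ the condition
-- d₃(z₁,z₂,z) ≤ d unfolds into the eight linear inequalities of an octagon.  Every anticode
-- lies in this finite octagon and the octagon is itself an anticode, so it is the unique
-- optimal one.
module Submission where

open import Defs
open import Data.Integer using (ℤ; +_; _+_; _-_; _*_; -_; _≤_; ∣_∣; -[1+_]; +≤+; -≤+; _≤?_; _≟_)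
open import Data.Integer.Properties
  using (≤-refl; ≤-trans; ≤-reflexive; ≤-total; +-mono-≤; +-monoˡ-≤; +-monoʳ-≤; i≤i+j; ∣-∣-≤;
         ∣i-j∣≡∣j-i∣; ∣-i∣≡∣i∣; i≤j⇒0≤j-i; 0≤i-j⇒j≤i; drop‿+≤+; +-injective; *-zeroʳ;
         +-identityʳ; +-commutativeSemigroup; module ≤-Reasoning)
open import Data.Integer.Tactic.RingSolver using (solve; solve-∀)
import Data.Nat.Tactic.RingSolver as ℕ-Solver
open import Data.Nat as ℕ using (ℕ; zero; suc; z≤n; s≤s)
import Data.Nat.Properties as ℕP
open import Data.Product using (_×_; _,_; proj₁; proj₂; ∃-syntax)
open import Data.Product.Properties using (≡-dec)
open import Data.Sum using (inj₁; inj₂)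
open import Data.Empty using (⊥-elim)
open import Data.List using (List; []; _∷_; length; map; upTo; filter; cartesianProduct)
open import Data.List.Relation.Unary.Any using (here; there)
open import Data.List.Relation.Unary.Any.Properties using (singleton⁻)
open import Data.List.Relation.Unary.All as All using (All)
open import Data.List.Relation.Unary.All.Properties using (¬Any⇒All¬)
open import Data.List.Relation.Unary.AllPairs using (_∷_)
open import Data.List.Relation.Unary.Unique.Propositional using (Unique)
open import Data.List.Relation.Unary.Unique.Propositional.Properties
  using (map⁺; upTo⁺; filter⁺; cartesianProduct⁺)
open import Data.List.Membership.Propositional using (_∈_)
open import Data.List.Membership.Propositional.Properties
  using (∈-map⁺; ∈-upTo⁺; ∈-filter⁺; ∈-filter⁻; ∈-cartesianProduct⁺)
import Data.List.Membership.DecPropositional as DecMembership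
open import Data.List.Relation.Binary.Subset.Propositional using (_⊆_)
open import Algebra.Properties.CommutativeSemigroup +-commutativeSemigroup using (interchange)
open import Function using (id)
open import Function.Bundles using (_⇔_; mk⇔; Equivalence)
open import Function.Construct.Composition using (_⇔-∘_)
open import Function.Construct.Symmetry using (⇔-sym)
open import Relation.Binary.Definitions using (DecidableEquality)
open import Relation.Binary.PropositionalEquality
  using (_≡_; _≢_; refl; sym; trans; cong; cong₂; subst; module ≡-Reasoning)
open import Relation.Nullary using (yes; no; contradiction)
open import Relation.Nullary.Decidable using (_×-dec_)
open import Relation.Unary using (Decidable)

open Equivalence using (to; from)

≤-by-difference : ∀ {a b p q : ℤ} → b - a ≡ q - p → a ≤ b → p ≤ q
≤-by-difference eq a≤b = 0≤i-j⇒j≤i (subst (+ 0 ≤_) eq (i≤j⇒0≤j-i a≤b))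

i≤+∣i∣ : ∀ i → i ≤ + ∣ i ∣
i≤+∣i∣ (+ n)    = ≤-refl
i≤+∣i∣ -[1+ n ] = -≤+

j-i≤+∣i-j∣ : ∀ i j → j - i ≤ + ∣ i - j ∣
j-i≤+∣i-j∣ i j = subst (λ n → j - i ≤ + n) (∣i-j∣≡∣j-i∣ j i) (i≤+∣i∣ (j - i))

+∣j-i∣≡j-i : ∀ {i j} → i ≤ j → + ∣ j - i ∣ ≡ j - i
+∣j-i∣≡j-i {i} {j} i≤j = trans (cong +_ (∣i-j∣≡∣j-i∣ j i)) (∣-∣-≤ i≤j)

pos-+₃ : ∀ {a b c A B C} → + a ≡ A → + b ≡ B → + c ≡ C → + (a ℕ.+ b ℕ.+ c) ≡ A + B + C
pos-+₃ refl refl refl = refl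

dist-ordered : ∀ {x₁ y₁ x₂ y₂} → x₁ ≤ x₂ → y₁ ≤ y₂ →
               + dist (x₁ , y₁) (x₂ , y₂) ≡ x₂ - x₁ + (y₂ - y₁)
dist-ordered x₁≤x₂ y₁≤y₂ = cong₂ _+_ (∣-∣-≤ x₁≤x₂) (∣-∣-≤ y₁≤y₂)

_≟ᴾ_ : DecidableEquality Pt
_≟ᴾ_ = ≡-dec _≟_ _≟_

Tristance≤-mono : ∀ {z₁ z₂ z d d'} → d ≤ d' → Tristance≤ z₁ z₂ z d → Tristance≤ z₁ z₂ z d'
Tristance≤-mono d≤d' (V , k , T , z₁∈ , z₂∈ , z∈ , k≤d) = V , k , T , z₁∈ , z₂∈ , z∈ , ≤-trans k≤d d≤d'

Spread≤ : List Pt → ℕ → Set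
Spread≤ V k = ∀ {a b e f} → a ∈ V → b ∈ V → e ∈ V → f ∈ V →
              proj₁ a - proj₁ b + (proj₂ e - proj₂ f) ≤ + k

spread-singleton : ∀ v → Spread≤ (v ∷ []) 0
spread-singleton (x , y) a∈ b∈ e∈ f∈
  with singleton⁻ a∈ | singleton⁻ b∈ | singleton⁻ e∈ | singleton⁻ f∈
... | refl | refl | refl | refl = ≤-reflexive (solve (x ∷ y ∷ []))

-- Moved v w a a' : a' is a with the new leaf w pulled back to its parent v.
data Moved {A : Set} (v w : A) : A → A → Set where
  stay : ∀ {a} → Moved v w a a
  back : Moved v w w v

Moved-map : ∀ {A B : Set} (g : A → B) {v w a a'} → Moved v w a a' → Moved (g v) (g w) (g a) (g a')
Moved-map g stay = stay
Moved-map g back = back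

retract : ∀ {A : Set} {V : List A} {v w a} → v ∈ V → a ∈ w ∷ V → ∃[ a' ] (a' ∈ V × Moved v w a a')
retract v∈V (here refl) = _ , v∈V , back
retract v∈V (there a∈V) = _ , a∈V , stay

moved-difference : ∀ {s t p p' q q' : ℤ} → Moved s t p p' → Moved s t q q' →
                   p - q ≤ p' - q' + + ∣ s - t ∣
moved-difference {s} {t} {p} {q = q} stay stay = i≤i+j (p - q) (+ ∣ s - t ∣)
moved-difference {s} {t} {q = q} back stay = begin
  t - q             ≡⟨ solve (s ∷ t ∷ q ∷ []) ⟩
  s - q + (t - s)   ≤⟨ +-monoʳ-≤ (s - q) (j-i≤+∣i-j∣ s t) ⟩
  s - q + + ∣ s - t ∣ ∎
  where open ≤-Reasoning
moved-difference {s} {t} {p} stay back = begin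
  p - t             ≡⟨ solve (s ∷ t ∷ p ∷ []) ⟩
  p - s + (s - t)   ≤⟨ +-monoʳ-≤ (p - s) (i≤+∣i∣ (s - t)) ⟩
  p - s + + ∣ s - t ∣ ∎
  where open ≤-Reasoning
moved-difference {s} {t} back back = begin
  t - t             ≡⟨ solve (s ∷ t ∷ []) ⟩
  s - s             ≤⟨ i≤i+j (s - s) (+ ∣ s - t ∣) ⟩
  s - s + + ∣ s - t ∣ ∎
  where open ≤-Reasoning

spread-grow : ∀ {V k v w} → Spread≤ V k → v ∈ V → Adj v w → Spread≤ (w ∷ V) (suc k)
spread-grow {k = k} {v} {w} spread v∈V adj {a} {b} {e} {f} a∈ b∈ e∈ f∈
  with retract v∈V a∈ | retract v∈V b∈ | retract v∈V e∈ | retract v∈V f∈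
... | a' , a'∈ , ma | b' , b'∈ , mb | e' , e'∈ , me | f' , f'∈ , mf = begin
  proj₁ a - proj₁ b + (proj₂ e - proj₂ f)
    ≤⟨ +-mono-≤ (moved-difference (Moved-map proj₁ ma) (Moved-map proj₁ mb))
                (moved-difference (Moved-map proj₂ me) (Moved-map proj₂ mf)) ⟩
  (proj₁ a' - proj₁ b' + + ∣ proj₁ v - proj₁ w ∣) + (proj₂ e' - proj₂ f' + + ∣ proj₂ v - proj₂ w ∣)
    ≡⟨ interchange (proj₁ a' - proj₁ b') _ (proj₂ e' - proj₂ f') _ ⟩
  proj₁ a' - proj₁ b' + (proj₂ e' - proj₂ f') + + dist v w
    ≤⟨ +-monoˡ-≤ (+ dist v w) (spread a'∈ b'∈ e'∈ f'∈) ⟩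
  + (k ℕ.+ dist v w)
    ≡⟨ cong (λ n → + (k ℕ.+ n)) adj ⟩
  + (k ℕ.+ 1)
    ≡⟨ cong +_ (ℕP.+-comm k 1) ⟩
  + suc k ∎
  where open ≤-Reasoning

tree-spread : ∀ {V k} → Tree V k → Spread≤ V k
tree-spread (single v)               = spread-singleton v
tree-spread (grow T v w v∈V adj w∉V) = spread-grow (tree-spread T) v∈V adj

data Extent (lo hi x : ℤ) : ℤ → Set where
  inner : Extent lo hi x (hi - lo)
  below : Extent lo hi x (hi - x)
  above : Extent lo hi x (x - lo)

-- For lo ≤ hi the width of {lo, hi, x} is the largest Extent, so this says that the
-- bounding box of z₁, z₂, z has half-perimeter at most d.
HalfPerimeter≤ : ℤ → Pt → Pt → Pt → Set
HalfPerimeter≤ d (x₁ , y₁) (x₂ , y₂) (x , y) =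
  ∀ {u v} → Extent x₁ x₂ x u → Extent y₁ y₂ y v → u + v ≤ d

extent-difference : ∀ (g : Pt → ℤ) {V z₁ z₂ z u} → z₁ ∈ V → z₂ ∈ V → z ∈ V →
                    Extent (g z₁) (g z₂) (g z) u → ∃[ a ] ∃[ b ] (a ∈ V × b ∈ V × g a - g b ≡ u)
extent-difference g z₁∈ z₂∈ z∈ inner = _ , _ , z₂∈ , z₁∈ , refl
extent-difference g z₁∈ z₂∈ z∈ below = _ , _ , z₂∈ , z∈ , refl
extent-difference g z₁∈ z₂∈ z∈ above = _ , _ , z∈ , z₁∈ , refl

tristance⇒halfPerimeter : ∀ {d} z₁ z₂ z → Tristance≤ z₁ z₂ z d → HalfPerimeter≤ d z₁ z₂ z
tristance⇒halfPerimeter (x₁ , y₁) (x₂ , y₂) (x , y) (V , k , T , z₁∈ , z₂∈ , z∈ , k≤d) ex ey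
  with extent-difference proj₁ z₁∈ z₂∈ z∈ ex | extent-difference proj₂ z₁∈ z₂∈ z∈ ey
... | a , b , a∈ , b∈ , refl | e , f , e∈ , f∈ , refl = ≤-trans (tree-spread T a∈ b∈ e∈ f∈) k≤d

Extension : List Pt → Pt → ℕ → Set
Extension V q n = ∃[ W ] ∃[ l ] (Tree W l × V ⊆ W × q ∈ W × l ℕ.≤ n)

attach : ∀ {V k v w} → Tree V k → v ∈ V → Adj v w → Extension V w (suc k)
attach {V} {k} {v} {w} T v∈V adj with DecMembership._∈?_ _≟ᴾ_ w V
... | yes w∈V = V , k , T , id , w∈V , ℕP.n≤1+n k
... | no w∉V  = w ∷ V , suc k , grow T v w v∈V adj w∉V , there , here refl , ℕP.≤-refl

chain : ∀ {V p q n m} → Extension V p n →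
        (∀ {W l} → Tree W l → p ∈ W → Extension W q (l ℕ.+ m)) → Extension V q (n ℕ.+ m)
chain {m = m} (W , l , T , V⊆W , p∈W , l≤n) continue with continue T p∈W
... | W' , l' , T' , W⊆W' , q∈W' , l'≤ =
  W' , l' , T' , (λ u∈V → W⊆W' (V⊆W u∈V)) , q∈W' , ℕP.≤-trans l'≤ (ℕP.+-monoˡ-≤ m l≤n)

unit-step : ∀ x y dx dy → ∣ dx ∣ ℕ.+ ∣ dy ∣ ≡ 1 → Adj (x , y) (x + dx , y + dy)
unit-step x y dx dy unit =
  trans (cong₂ (λ a b → ∣ a ∣ ℕ.+ ∣ b ∣) (step-back x dx) (step-back y dy))
        (trans (cong₂ ℕ._+_ (∣-i∣≡∣i∣ dx) (∣-i∣≡∣i∣ dy)) unit)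
  where
    step-back : ∀ i di → i - (i + di) ≡ - di
    step-back = solve-∀

walk : ∀ n {V k x y} (dx dy : ℤ) → ∣ dx ∣ ℕ.+ ∣ dy ∣ ≡ 1 → Tree V k → (x , y) ∈ V →
       Extension V (x + + n * dx , y + + n * dy) (k ℕ.+ n)
walk zero {V} {k} {x} {y} dx dy _ T p∈V =
  V , k , T , id , subst (_∈ V) (sym (cong₂ _,_ (no-steps x dx) (no-steps y dy))) p∈V , ℕP.m≤m+n k 0
  where
    no-steps : ∀ i di → i + + 0 * di ≡ i
    no-steps i di = solve (i ∷ di ∷ [])
walk (suc n) {V} {k} {x} {y} dx dy unit T p∈V =
  subst (Extension V _) (sym (ℕP.+-suc k n))
    (subst (λ q → Extension V q (suc k ℕ.+ n)) (cong₂ _,_ (one-more x dx (+ n)) (one-more y dy (+ n)))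
      (chain (attach T p∈V (unit-step x y dx dy unit)) (λ T' w∈ → walk n dx dy unit T' w∈)))
  where
    one-more : ∀ i di m → i + di + m * di ≡ i + (+ 1 + m) * di
    one-more = solve-∀

toward : ∀ a b → ∃[ s ] (∣ s ∣ ≡ 1 × a + + ∣ a - b ∣ * s ≡ b)
toward a b with ≤-total a b
... | inj₁ a≤b = + 1 , refl , (begin
  a + + ∣ a - b ∣ * + 1 ≡⟨ cong (λ n → a + n * + 1) (∣-∣-≤ a≤b) ⟩
  a + (b - a) * + 1     ≡⟨ solve (a ∷ b ∷ []) ⟩
  b                     ∎)
  where open ≡-Reasoning
... | inj₂ b≤a = - + 1 , refl , (begin
  a + + ∣ a - b ∣ * - + 1 ≡⟨ cong (λ n → a + n * - + 1) (+∣j-i∣≡j-i b≤a) ⟩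
  a + (a - b) * - + 1     ≡⟨ solve (a ∷ b ∷ []) ⟩
  b                       ∎)
  where open ≡-Reasoning

i+n*0≡i : ∀ i n → i + + n * + 0 ≡ i
i+n*0≡i i n = trans (cong (λ j → i + j) (*-zeroʳ (+ n))) (+-identityʳ i)

walk-horizontal : ∀ {V k x y} → Tree V k → (x , y) ∈ V → ∀ x' →
                  Extension V (x' , y) (k ℕ.+ ∣ x - x' ∣)
walk-horizontal {V} {x = x} {y} T p∈V x' with toward x x'
... | s , ∣s∣≡1 , x↝x' =
  subst (λ q → Extension V q _) (cong₂ _,_ x↝x' (i+n*0≡i y ∣ x - x' ∣))
    (walk ∣ x - x' ∣ s (+ 0) (trans (ℕP.+-identityʳ ∣ s ∣) ∣s∣≡1) T p∈V)

walk-vertical : ∀ {V k x y} → Tree V k → (x , y) ∈ V → ∀ y' →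
                Extension V (x , y') (k ℕ.+ ∣ y - y' ∣)
walk-vertical {V} {x = x} {y} T p∈V y' with toward y y'
... | t , ∣t∣≡1 , y↝y' =
  subst (λ q → Extension V q _) (cong₂ _,_ (i+n*0≡i x ∣ y - y' ∣) y↝y')
    (walk ∣ y - y' ∣ (+ 0) t ∣t∣≡1 T p∈V)

extend : ∀ {V k p} → Tree V k → p ∈ V → ∀ q → Extension V q (k ℕ.+ dist p q)
extend {V} {k} {x , y} T p∈V (x' , y') =
  subst (Extension V _) (ℕP.+-assoc k ∣ x - x' ∣ ∣ y - y' ∣)
    (chain (walk-horizontal T p∈V x') (λ T' p'∈ → walk-vertical T' p'∈ y'))

star : ∀ m z₁ z₂ z → Tristance≤ z₁ z₂ z (+ (dist m z₁ ℕ.+ dist m z₂ ℕ.+ dist m z))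
star m z₁ z₂ z with extend (single m) (here refl) z₁
... | V₁ , k₁ , T₁ , m⊆V₁ , z₁∈V₁ , k₁≤ with extend T₁ (m⊆V₁ (here refl)) z₂
... | V₂ , k₂ , T₂ , V₁⊆V₂ , z₂∈V₂ , k₂≤ with extend T₂ (V₁⊆V₂ (m⊆V₁ (here refl))) z
... | V₃ , k₃ , T₃ , V₂⊆V₃ , z∈V₃ , k₃≤ =
  V₃ , k₃ , T₃ , V₂⊆V₃ (V₁⊆V₂ z₁∈V₁) , V₂⊆V₃ z₂∈V₂ , z∈V₃ ,
  +≤+ (ℕP.≤-trans k₃≤ (ℕP.+-monoˡ-≤ (dist m z) (ℕP.≤-trans k₂≤ (ℕP.+-monoˡ-≤ (dist m z₂) k₁≤))))

-- m is the median of lo, hi and x.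
median-cost : ∀ {lo hi} → lo ≤ hi → ∀ x →
              ∃[ m ] ∃[ u ] (Extent lo hi x u × + (∣ m - lo ∣ ℕ.+ ∣ m - hi ∣ ℕ.+ ∣ m - x ∣) ≡ u)
median-cost {lo} {hi} lo≤hi x with ≤-total x lo | ≤-total x hi
... | inj₁ x≤lo | _ = lo , hi - x , below ,
  trans (pos-+₃ (∣-∣-≤ (≤-refl {lo})) (∣-∣-≤ lo≤hi) (+∣j-i∣≡j-i x≤lo)) (solve (lo ∷ hi ∷ x ∷ []))
... | inj₂ lo≤x | inj₁ x≤hi = x , hi - lo , inner ,
  trans (pos-+₃ (+∣j-i∣≡j-i lo≤x) (∣-∣-≤ x≤hi) (∣-∣-≤ (≤-refl {x}))) (solve (lo ∷ hi ∷ x ∷ []))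
... | inj₂ _ | inj₂ hi≤x = hi , x - lo , above ,
  trans (pos-+₃ (+∣j-i∣≡j-i lo≤hi) (∣-∣-≤ (≤-refl {hi})) (∣-∣-≤ hi≤x)) (solve (lo ∷ hi ∷ x ∷ []))

halfPerimeter⇒tristance : ∀ {d x₁ y₁ x₂ y₂} → x₁ ≤ x₂ → y₁ ≤ y₂ → ∀ z →
                          HalfPerimeter≤ d (x₁ , y₁) (x₂ , y₂) z → Tristance≤ (x₁ , y₁) (x₂ , y₂) z d
halfPerimeter⇒tristance {d} {x₁} {y₁} {x₂} {y₂} x₁≤x₂ y₁≤y₂ (x , y) bound
  with median-cost x₁≤x₂ x | median-cost y₁≤y₂ y
... | mx , u , ex , costx | my , v , ey , costy =
  Tristance≤-mono (subst (_≤ d) (sym star-length) (bound ex ey)) (star (mx , my) _ _ _)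
  where
    regroup : ∀ a b c a' b' c' →
              a ℕ.+ a' ℕ.+ (b ℕ.+ b') ℕ.+ (c ℕ.+ c') ≡ a ℕ.+ b ℕ.+ c ℕ.+ (a' ℕ.+ b' ℕ.+ c')
    regroup = ℕ-Solver.solve-∀
    star-length : + (dist (mx , my) (x₁ , y₁) ℕ.+ dist (mx , my) (x₂ , y₂) ℕ.+ dist (mx , my) (x , y))
                  ≡ u + v
    star-length =
      trans (cong +_ (regroup (∣ mx - x₁ ∣) (∣ mx - x₂ ∣) (∣ mx - x ∣)
                              (∣ my - y₁ ∣) (∣ my - y₂ ∣) (∣ my - y ∣)))
            (cong₂ _+_ costx costy)

Octagon : ℤ → ℤ → ℤ → ℤ → ℤ → Pt → Set
Octagon x₁ y₁ x₂ y₂ c (x , y) =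
  ((x₁ - c ≤ x × x ≤ x₂ + c) ×
   (y₁ - c ≤ y × y ≤ y₂ + c) ×
   (x₁ + y₁ - c ≤ x + y × x + y ≤ x₂ + y₂ + c) ×
   (x₁ - y₂ - c ≤ x - y × x - y ≤ x₂ - y₁ + c))

octagon⇔halfPerimeter : ∀ {x₁ y₁ x₂ y₂ d} → x₂ - x₁ + (y₂ - y₁) ≤ d → ∀ z →
  Octagon x₁ y₁ x₂ y₂ (d - (x₂ - x₁ + (y₂ - y₁))) z ⇔ HalfPerimeter≤ d (x₁ , y₁) (x₂ , y₂) z
octagon⇔halfPerimeter {x₁} {y₁} {x₂} {y₂} {d} D≤d (x , y) = mk⇔ to-bound from-bound
  where
    c = d - (x₂ - x₁ + (y₂ - y₁))
    west : x - (x₁ - (d - (x₂ - x₁ + (y₂ - y₁)))) ≡ d - (x₂ - x + (y₂ - y₁))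
    west = solve (x₁ ∷ y₁ ∷ x₂ ∷ y₂ ∷ d ∷ x ∷ y ∷ [])
    east : x₂ + (d - (x₂ - x₁ + (y₂ - y₁))) - x ≡ d - (x - x₁ + (y₂ - y₁))
    east = solve (x₁ ∷ y₁ ∷ x₂ ∷ y₂ ∷ d ∷ x ∷ y ∷ [])
    south : y - (y₁ - (d - (x₂ - x₁ + (y₂ - y₁)))) ≡ d - (x₂ - x₁ + (y₂ - y))
    south = solve (x₁ ∷ y₁ ∷ x₂ ∷ y₂ ∷ d ∷ x ∷ y ∷ [])
    north : y₂ + (d - (x₂ - x₁ + (y₂ - y₁))) - y ≡ d - (x₂ - x₁ + (y - y₁))
    north = solve (x₁ ∷ y₁ ∷ x₂ ∷ y₂ ∷ d ∷ x ∷ y ∷ [])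
    south-west : x + y - (x₁ + y₁ - (d - (x₂ - x₁ + (y₂ - y₁)))) ≡ d - (x₂ - x + (y₂ - y))
    south-west = solve (x₁ ∷ y₁ ∷ x₂ ∷ y₂ ∷ d ∷ x ∷ y ∷ [])
    north-east : x₂ + y₂ + (d - (x₂ - x₁ + (y₂ - y₁))) - (x + y) ≡ d - (x - x₁ + (y - y₁))
    north-east = solve (x₁ ∷ y₁ ∷ x₂ ∷ y₂ ∷ d ∷ x ∷ y ∷ [])
    north-west : x - y - (x₁ - y₂ - (d - (x₂ - x₁ + (y₂ - y₁)))) ≡ d - (x₂ - x + (y - y₁))
    north-west = solve (x₁ ∷ y₁ ∷ x₂ ∷ y₂ ∷ d ∷ x ∷ y ∷ [])
    south-east : x₂ - y₁ + (d - (x₂ - x₁ + (y₂ - y₁))) - (x - y) ≡ d - (x - x₁ + (y₂ - y))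
    south-east = solve (x₁ ∷ y₁ ∷ x₂ ∷ y₂ ∷ d ∷ x ∷ y ∷ [])

    to-bound : Octagon x₁ y₁ x₂ y₂ c (x , y) → HalfPerimeter≤ d (x₁ , y₁) (x₂ , y₂) (x , y)
    to-bound _                            inner inner = D≤d
    to-bound ((w , _) , _)                below inner = ≤-by-difference west w
    to-bound ((_ , e) , _)                above inner = ≤-by-difference east e
    to-bound (_ , (s , _) , _)            inner below = ≤-by-difference south s
    to-bound (_ , (_ , n) , _)            inner above = ≤-by-difference north n
    to-bound (_ , _ , (sw , _) , _)       below below = ≤-by-difference south-west sw
    to-bound (_ , _ , (_ , ne) , _)       above above = ≤-by-difference north-east ne
    to-bound (_ , _ , _ , (nw , _))       below above = ≤-by-difference north-west nw
    to-bound (_ , _ , _ , (_ , se))       above below = ≤-by-difference south-east se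

    from-bound : HalfPerimeter≤ d (x₁ , y₁) (x₂ , y₂) (x , y) → Octagon x₁ y₁ x₂ y₂ c (x , y)
    from-bound hp =
      (≤-by-difference (sym west) (hp below inner) , ≤-by-difference (sym east) (hp above inner)) ,
      (≤-by-difference (sym south) (hp inner below) , ≤-by-difference (sym north) (hp inner above)) ,
      (≤-by-difference (sym south-west) (hp below below) ,
       ≤-by-difference (sym north-east) (hp above above)) ,
      (≤-by-difference (sym north-west) (hp below above) ,
       ≤-by-difference (sym south-east) (hp above below))

tristance⇔octagon : ∀ {x₁ y₁ x₂ y₂ d} → x₁ ≤ x₂ → y₁ ≤ y₂ → + dist (x₁ , y₁) (x₂ , y₂) ≤ d → ∀ z →
  Tristance≤ (x₁ , y₁) (x₂ , y₂) z d ⇔ Octagon x₁ y₁ x₂ y₂ (d - + dist (x₁ , y₁) (x₂ , y₂)) z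
tristance⇔octagon x₁≤x₂ y₁≤y₂ D≤d z rewrite dist-ordered x₁≤x₂ y₁≤y₂ =
  ⇔-sym (octagon⇔halfPerimeter D≤d z)
  ⇔-∘ mk⇔ (tristance⇒halfPerimeter _ _ z) (halfPerimeter⇒tristance x₁≤x₂ y₁≤y₂ z)

interval : ℤ → ℤ → List ℤ
interval lo hi = map (λ i → lo + + i) (upTo (suc ∣ hi - lo ∣))

interval-unique : ∀ lo hi → Unique (interval lo hi)
interval-unique lo hi = map⁺ lo+-injective (upTo⁺ (suc ∣ hi - lo ∣))
  where
    lo+-injective : ∀ {i j} → lo + + i ≡ lo + + j → i ≡ j
    lo+-injective {i} {j} eq = +-injective (begin
      + i           ≡⟨ sym (cancel lo (+ i)) ⟩
      lo + + i - lo ≡⟨ cong (_- lo) eq ⟩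
      lo + + j - lo ≡⟨ cancel lo (+ j) ⟩
      + j           ∎)
      where
        open ≡-Reasoning
        cancel : ∀ a b → a + b - a ≡ b
        cancel = solve-∀

∈-interval : ∀ {lo hi z} → lo ≤ z → z ≤ hi → z ∈ interval lo hi
∈-interval {lo} {hi} {z} lo≤z z≤hi =
  subst (_∈ interval lo hi) lo+∣z-lo∣≡z
    (∈-map⁺ (λ i → lo + + i) (∈-upTo⁺ (s≤s (drop‿+≤+ ∣z-lo∣≤∣hi-lo∣))))
  where
    ∣z-lo∣≤∣hi-lo∣ : + ∣ z - lo ∣ ≤ + ∣ hi - lo ∣
    ∣z-lo∣≤∣hi-lo∣ rewrite +∣j-i∣≡j-i lo≤z | +∣j-i∣≡j-i (≤-trans lo≤z z≤hi) = +-monoˡ-≤ (- lo) z≤hi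
    lo+∣z-lo∣≡z : lo + + ∣ z - lo ∣ ≡ z
    lo+∣z-lo∣≡z = trans (cong (λ j → lo + j) (+∣j-i∣≡j-i lo≤z)) (solve (lo ∷ z ∷ []))

octagon? : ∀ x₁ y₁ x₂ y₂ c → Decidable (Octagon x₁ y₁ x₂ y₂ c)
octagon? x₁ y₁ x₂ y₂ c (x , y) =
  ((x₁ - c ≤? x) ×-dec (x ≤? x₂ + c)) ×-dec
  ((y₁ - c ≤? y) ×-dec (y ≤? y₂ + c)) ×-dec
  ((x₁ + y₁ - c ≤? x + y) ×-dec (x + y ≤? x₂ + y₂ + c)) ×-dec
  ((x₁ - y₂ - c ≤? x - y) ×-dec (x - y ≤? x₂ - y₁ + c))

octagon-points : ℤ → ℤ → ℤ → ℤ → ℤ → List Pt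
octagon-points x₁ y₁ x₂ y₂ c =
  filter (octagon? x₁ y₁ x₂ y₂ c)
    (cartesianProduct (interval (x₁ - c) (x₂ + c)) (interval (y₁ - c) (y₂ + c)))

octagon-points-unique : ∀ x₁ y₁ x₂ y₂ c → Unique (octagon-points x₁ y₁ x₂ y₂ c)
octagon-points-unique x₁ y₁ x₂ y₂ c =
  filter⁺ (octagon? x₁ y₁ x₂ y₂ c)
    (cartesianProduct⁺ (interval-unique (x₁ - c) (x₂ + c)) (interval-unique (y₁ - c) (y₂ + c)))

∈-octagon-points⇔ : ∀ x₁ y₁ x₂ y₂ c z → z ∈ octagon-points x₁ y₁ x₂ y₂ c ⇔ Octagon x₁ y₁ x₂ y₂ c z
∈-octagon-points⇔ x₁ y₁ x₂ y₂ c (x , y) = mk⇔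
  (λ z∈ → proj₂ (∈-filter⁻ (octagon? x₁ y₁ x₂ y₂ c) z∈))
  (λ { oct@((w , e) , (s , n) , _) →
       ∈-filter⁺ (octagon? x₁ y₁ x₂ y₂ c) (∈-cartesianProduct⁺ (∈-interval w e) (∈-interval s n)) oct })

module _ {A : Set} where

  extract : ∀ {u : A} {S} → u ∈ S →
            ∃[ S' ] (length S ≡ suc (length S') × (∀ {v} → v ∈ S → v ≢ u → v ∈ S'))
  extract (here refl) = _ , refl , λ { (here refl) v≢u → contradiction refl v≢u ; (there v∈) _ → v∈ }
  extract {S = s ∷ S} (there u∈S) with extract u∈S
  ... | S' , len , keep = s ∷ S' , cong suc len ,
        λ { (here refl) _ → here refl ; (there v∈S) v≢u → there (keep v∈S v≢u) }

  unique-⊆⇒length≤ : ∀ {B S : List A} → Unique B → B ⊆ S → length B ℕ.≤ length S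
  unique-⊆⇒length≤ {[]}    _              _   = z≤n
  unique-⊆⇒length≤ {b ∷ B} (b∉B ∷ B-unique) B⊆S with extract (B⊆S (here refl))
  ... | S' , len , keep = subst (suc (length B) ℕ.≤_) (sym len)
        (s≤s (unique-⊆⇒length≤ B-unique
          (λ u∈B → keep (B⊆S (there u∈B)) (λ u≡b → All.lookup b∉B u∈B (sym u≡b)))))

  ⊆-length≥⇒⊇ : DecidableEquality A → ∀ {B S : List A} → Unique B → B ⊆ S →
                length S ℕ.≤ length B → S ⊆ B
  ⊆-length≥⇒⊇ _≟ᴬ_ {B} {S} B-unique B⊆S S≤B {u} u∈S with DecMembership._∈?_ _≟ᴬ_ u B
  ... | yes u∈B = u∈B
  ... | no u∉B  = ⊥-elim (ℕP.<-irrefl refl (ℕP.≤-trans longer S≤B))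
    where
      longer : suc (length B) ℕ.≤ length S
      longer = unique-⊆⇒length≤ (¬Any⇒All¬ B u∉B ∷ B-unique)
                 (λ { (here refl) → u∈S ; (there v∈B) → B⊆S v∈B })

theorem8 : (x₁ y₁ x₂ y₂ d : ℤ) →
    (x₁ , y₁) ≢ (x₂ , y₂) → x₁ ≤ x₂ → y₁ ≤ y₂ →
    + dist (x₁ , y₁) (x₂ , y₂) ≤ d →
    let c = d - + dist (x₁ , y₁) (x₂ , y₂) in
    (∃[ A ] IsOptimalAnticode d (x₁ , y₁) (x₂ , y₂) A) ×
    (∀ (A : List Pt) → IsOptimalAnticode d (x₁ , y₁) (x₂ , y₂) A →
      ∀ (x y : ℤ) →
        ((x , y) ∈ A) ⇔
        ((x₁ - c ≤ x × x ≤ x₂ + c) ×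
         (y₁ - c ≤ y × y ≤ y₂ + c) ×
         (x₁ + y₁ - c ≤ x + y × x + y ≤ x₂ + y₂ + c) ×
         (x₁ - y₂ - c ≤ x - y × x - y ≤ x₂ - y₁ + c)))
theorem8 x₁ y₁ x₂ y₂ d _ x₁≤x₂ y₁≤y₂ D≤d = (S , S-anticode , S-maximum) , optimal-is-octagon
  where
    c = d - + dist (x₁ , y₁) (x₂ , y₂)
    S = octagon-points x₁ y₁ x₂ y₂ c
    tristance⇔∈S : ∀ z → Tristance≤ (x₁ , y₁) (x₂ , y₂) z d ⇔ z ∈ S
    tristance⇔∈S z = ⇔-sym (∈-octagon-points⇔ x₁ y₁ x₂ y₂ c z) ⇔-∘ tristance⇔octagon x₁≤x₂ y₁≤y₂ D≤d z
    anticode⊆S : ∀ {B} → IsAnticode d (x₁ , y₁) (x₂ , y₂) B → B ⊆ S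
    anticode⊆S (_ , B-close) z∈B = to (tristance⇔∈S _) (All.lookup B-close z∈B)
    S-anticode : IsAnticode d (x₁ , y₁) (x₂ , y₂) S
    S-anticode = octagon-points-unique x₁ y₁ x₂ y₂ c , All.tabulate (from (tristance⇔∈S _))
    S-maximum : ∀ B → IsAnticode d (x₁ , y₁) (x₂ , y₂) B → length B ℕ.≤ length S
    S-maximum B B-anticode = unique-⊆⇒length≤ (proj₁ B-anticode) (anticode⊆S B-anticode)
    optimal-is-octagon : ∀ A → IsOptimalAnticode d (x₁ , y₁) (x₂ , y₂) A →
                         ∀ x y → (x , y) ∈ A ⇔ Octagon x₁ y₁ x₂ y₂ c (x , y)
    optimal-is-octagon A (A-anticode , A-maximum) x y =
      ∈-octagon-points⇔ x₁ y₁ x₂ y₂ c (x , y) ⇔-∘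
      mk⇔ (anticode⊆S A-anticode)
          (⊆-length≥⇒⊇ _≟ᴾ_ (proj₁ A-anticode) (anticode⊆S A-anticode) (A-maximum S S-anticode))
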